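{- For integers $\ell\ge 2$ and $k\ge1$, $$\Xi(k,\ell)\le\max\Bigl\{\frac{\ell}{\ell-1}(k-2),\ k\Bigr\}.$$
   Context: All graphs are finite, simple and undirected. For a graph $G=(V,E)$ and $x\in V$, $N[x]=\{x\}\cup\{y: xy\in E\}$; for $X\subseteq V$, $N[X]=\bigcup_{x\in X}N[x]$ (so $N[\emptyset]=\emptyset$). A set $C\subseteq V$ is $(1,\le\ell)$-identifying if $N[X]\cap C\neq N[Y]\cap C$ for all distinct $X,Y\subseteq V$ with $|X|\le\ell$, $|Y|\le\ell$. For $n\ge k\ge1$ and $\ell\ge1$, $\mathfrak{Gr}(n,k,\ell)$ is the set of graphs on $n$ vertices in which every $k$-element subset of vertices is $(1,\le\ell)$-identifying. $\Xi(k,\ell)=\max\{n\ge k:\mathfrak{Gr}(n,k,\ell)\ne\emptyset\}$ (note the edgeless graph on $k$ vertices lies in $\mathfrak{Gr}(k,k,\ell)$). -}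

module Defs where

open import Data.Nat using (ℕ; _≤_)
open import Data.Bool using (Bool; true; false; _∧_; _∨_)
open import Data.Fin using (Fin; _≟_)
open import Data.Fin.Subset using (Subset; _∩_; ∣_∣; ⋃)
open import Data.List using (List; allFin; map; filterᵇ)
open import Data.Vec using (tabulate; lookup)
open import Relation.Nullary using (¬_)
open import Relation.Nullary.Decidable using (⌊_⌋)
open import Relation.Binary.PropositionalEquality using (_≡_; _≢_)

record Graph (n : ℕ) : Set where
  field
    adj    : Fin n → Fin n → Bool
    sym    : ∀ x y → adj x y ≡ adj y x
    irrefl : ∀ x → adj x x ≡ false
open Graph public

N[_]_ : ∀ {n} → Graph n → Fin n → Subset n
N[ G ] x = tabulate (λ y → ⌊ x ≟ y ⌋ ∨ adj G x y)

N[_]ˢ_ : ∀ {n} → Graph n → Subset n → Subset n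
N[_]ˢ_ {n} G X = ⋃ (map (N[ G ]_) (filterᵇ (λ x → lookup X x) (allFin n)))

Identifying : ∀ {n} → Graph n → ℕ → Subset n → Set
Identifying {n} G ℓ C =
  (X Y : Subset n) → ∣ X ∣ ≤ ℓ → ∣ Y ∣ ≤ ℓ → X ≢ Y →
  ((N[ G ]ˢ X) ∩ C) ≢ ((N[ G ]ˢ Y) ∩ C)

InGr : ∀ {n} → Graph n → ℕ → ℕ → Set
InGr {n} G k ℓ = (C : Subset n) → ∣ C ∣ ≡ k → Identifying G ℓ C

-- Put d = n − k. If N[X] and N[Y] differ only inside a set S, for distinct X, Y of size at most ℓ,
-- then |S| > d: otherwise the at least k vertices outside S contain a k-set that does not separate
-- X from Y. Comparing X with X ∪ {v} shows that each new vertex adds more than d vertices to N[X],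
-- and comparing X ∪ {u} with X ∪ {u, v} for an edge uv outside N[X] improves this to d + 2 (such
-- an edge exists when d ≥ 1, as a new vertex then adds at least two vertices). Growing X greedily
-- for ℓ − 1 steps gives |N[X]| ≥ (ℓ − 1)(d + 2), and comparing X ∪ {v} with X ∪ {u} shows that at
-- least d + 2 vertices lie outside N[X]. So ℓ(d + 2) ≤ n = k + d, i.e. (ℓ − 1)n ≤ ℓ(k − 2).

module Submission where

open import Defs using (Graph; adj; N[_]_; N[_]ˢ_; InGr)
open import Data.Nat using (ℕ; zero; suc; _+_; _∸_; _≤_; _<_; _≤?_; z≤n; s≤s; NonZero)
import Data.Nat as ℕ
open import Data.Nat.Properties
  using (≤-refl; ≤-reflexive; ≤-trans; <⇒≤; ≤-<-trans; <-≤-trans; ≰⇒>; <⇒≱; +-comm; +-suc; +-mono-≤;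
         +-monoʳ-≤; +-cancelʳ-≡; m≤m+n; m<m*n; m<n⇒0<n∸m; m+[n∸m]≡n; m∸[m∸n]≡n; ∸-monoʳ-≤;
         m≤n⇒∃[o]m+o≡n; module ≤-Reasoning)
import Data.Nat.Properties as ℕ
open import Data.Nat.Tactic.RingSolver using (solve-∀)
open import Data.Bool using (true; false; _∨_; T?)
open import Data.Bool.Properties using (T-≡)
open import Data.Fin using (Fin)
open import Data.Fin.Properties using (any?)
open import Data.Fin.Subset hiding (_-_)
open import Data.Fin.Subset.Properties
open import Data.List using (List; []; _∷_; allFin; map; filterᵇ)
open import Data.List.Relation.Unary.Any using (here; there)
open import Data.List.Membership.Propositional using () renaming (_∈_ to _∈ₗ_)
open import Data.List.Membership.Propositional.Properties using (∈-map⁺; ∈-map⁻; ∈-filter⁺; ∈-filter⁻; ∈-allFin)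
open import Data.Vec using ([]; _∷_; lookup; here; there)
open import Data.Vec.Properties using (lookup∘tabulate; lookup⇒[]=; []=⇒lookup)
open import Data.Product using (∃; _×_; _,_; proj₂)
open import Data.Sum using (inj₁; inj₂; [_,_])
open import Function using (_∘_; Equivalence)
open import Relation.Nullary using (¬?; yes; no; contradiction)
open import Relation.Nullary.Decidable using (fromWitness; decidable-stable; _×-dec_)
open import Relation.Binary.PropositionalEquality using (_≡_; _≢_; refl; sym; trans; cong; subst)

∣p∪q∣≡∣p∣+∣q─p∣ : ∀ {n} (p q : Subset n) → ∣ p ∪ q ∣ ≡ ∣ p ∣ + ∣ q ─ p ∣
∣p∪q∣≡∣p∣+∣q─p∣ []          []          = refl
∣p∪q∣≡∣p∣+∣q─p∣ (true  ∷ p) (_     ∷ q) = cong suc (∣p∪q∣≡∣p∣+∣q─p∣ p q)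
∣p∪q∣≡∣p∣+∣q─p∣ (false ∷ p) (true  ∷ q) = trans (cong suc (∣p∪q∣≡∣p∣+∣q─p∣ p q)) (sym (+-suc ∣ p ∣ _))
∣p∪q∣≡∣p∣+∣q─p∣ (false ∷ p) (false ∷ q) = ∣p∪q∣≡∣p∣+∣q─p∣ p q

∣p∪⁅x⁆∣≤1+∣p∣ : ∀ {n} (p : Subset n) x → ∣ p ∪ ⁅ x ⁆ ∣ ≤ suc ∣ p ∣
∣p∪⁅x⁆∣≤1+∣p∣ p x = begin
  ∣ p ∪ ⁅ x ⁆ ∣              ≡⟨ ∣p∪q∣≡∣p∣+∣q─p∣ p ⁅ x ⁆ ⟩
  (∣ p ∣) + (∣ ⁅ x ⁆ ─ p ∣)  ≤⟨ +-monoʳ-≤ ∣ p ∣ (∣p─q∣≤∣p∣ ⁅ x ⁆ p) ⟩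
  (∣ p ∣) + (∣ ⁅ x ⁆ ∣)      ≡⟨ cong (_+_ ∣ p ∣) (∣⁅x⁆∣≡1 x) ⟩
  (∣ p ∣) + 1                ≡⟨ +-comm ∣ p ∣ 1 ⟩
  suc ∣ p ∣                  ∎
  where open ≤-Reasoning

∣p∣+∣∁p∣≡n : ∀ {n} (p : Subset n) → ∣ p ∣ + ∣ ∁ p ∣ ≡ n
∣p∣+∣∁p∣≡n p = trans (cong (_+_ ∣ p ∣) (∣∁p∣≡n∸∣p∣ p)) (m+[n∸m]≡n (∣p∣≤n p))

∣q∣<∣p∣⇒∃[x∈p∖q] : ∀ {n} {p q : Subset n} → ∣ q ∣ < ∣ p ∣ → ∃ λ x → x ∈ p × x ∉ q
∣q∣<∣p∣⇒∃[x∈p∖q] {p = p} {q} ∣q∣<∣p∣ with any? (λ x → x ∈? p ×-dec ¬? (x ∈? q))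
... | yes witness = witness
... | no  none    = contradiction (p⊆q⇒∣p∣≤∣q∣ p⊆q) (<⇒≱ ∣q∣<∣p∣)
  where
  p⊆q : p ⊆ q
  p⊆q {x} x∈p = decidable-stable (x ∈? q) (λ x∉q → none (x , x∈p , x∉q))

∣p∣<n⇒∃[x∉p] : ∀ {n} (p : Subset n) → ∣ p ∣ < n → ∃ (_∉ p)
∣p∣<n⇒∃[x∉p] {n} p ∣p∣<n =
  let x , _ , x∉p = ∣q∣<∣p∣⇒∃[x∈p∖q] {p = ⊤} {q = p} (subst (∣ p ∣ <_) (sym (∣⊤∣≡n n)) ∣p∣<n) in x , x∉p

0<∣p∣⇒Nonempty : ∀ {n} (p : Subset n) → 0 < ∣ p ∣ → Nonempty p
0<∣p∣⇒Nonempty {n} p 0<∣p∣ =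
  let x , x∈p , _ = ∣q∣<∣p∣⇒∃[x∈p∖q] {p = p} {q = ⊥} (subst (_< ∣ p ∣) (sym (∣⊥∣≡0 n)) 0<∣p∣) in x , x∈p

1<∣p∣⇒∃[x∈p]x≢y : ∀ {n} (p : Subset n) → 1 < ∣ p ∣ → ∀ y → ∃ λ x → x ∈ p × x ≢ y
1<∣p∣⇒∃[x∈p]x≢y p 1<∣p∣ y =
  let x , x∈p , x∉⁅y⁆ = ∣q∣<∣p∣⇒∃[x∈p∖q] {p = p} {q = ⁅ y ⁆} (subst (_< ∣ p ∣) (sym (∣⁅x⁆∣≡1 y)) 1<∣p∣)
  in x , x∈p , x∉⁅y⁆⇒x≢y x∉⁅y⁆

k≤∣p∣⇒∃[C⊆p]∣C∣≡k : ∀ {n} k (p : Subset n) → k ≤ ∣ p ∣ → ∃ λ C → C ⊆ p × ∣ C ∣ ≡ k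
k≤∣p∣⇒∃[C⊆p]∣C∣≡k {n} zero    p           _           = ⊥ , ⊥⊆ , ∣⊥∣≡0 n
k≤∣p∣⇒∃[C⊆p]∣C∣≡k     (suc k) (true  ∷ p) (s≤s k≤∣p∣) =
  let C , C⊆p , ∣C∣≡k = k≤∣p∣⇒∃[C⊆p]∣C∣≡k k p k≤∣p∣ in true ∷ C , s⊆s C⊆p , cong suc ∣C∣≡k
k≤∣p∣⇒∃[C⊆p]∣C∣≡k     (suc k) (false ∷ p) k<∣p∣       =
  let C , C⊆p , ∣C∣≡k = k≤∣p∣⇒∃[C⊆p]∣C∣≡k (suc k) p k<∣p∣ in false ∷ C , s⊆s C⊆p , ∣C∣≡k

x∈p─q⇒x∉q : ∀ {n} {x : Fin n} {p q : Subset n} → x ∈ p ─ q → x ∉ q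
x∈p─q⇒x∉q {p = true ∷ _} {false ∷ _} here        ()
x∈p─q⇒x∉q {p = _ ∷ _}    {_ ∷ _}     (there x∈) (there x∈q) = x∈p─q⇒x∉q x∈ x∈q

q⊆r⇒p─r⊆p─q : ∀ {n} {p q r : Subset n} → q ⊆ r → p ─ r ⊆ p ─ q
q⊆r⇒p─r⊆p─q {p = p} {r = r} q⊆r x∈p─r =
  x∈p∧x∉q⇒x∈p─q (p─q⊆p p r x∈p─r) (x∈p─q⇒x∉q x∈p─r ∘ q⊆r)

p∪q⊆p∪[q─p] : ∀ {n} (p q : Subset n) → p ∪ q ⊆ p ∪ (q ─ p)
p∪q⊆p∪[q─p] p q {x} x∈p∪q with x∈p∪q⁻ p q x∈p∪q | x ∈? p
... | inj₁ x∈p | _       = x∈p∪q⁺ (inj₁ x∈p)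
... | inj₂ _   | yes x∈p = x∈p∪q⁺ (inj₁ x∈p)
... | inj₂ x∈q | no  x∉p = x∈p∪q⁺ (inj₂ (x∈p∧x∉q⇒x∈p─q x∈q x∉p))

q⊆r⇒p⊆r∪∁q : ∀ {n} {p q r : Subset n} → q ⊆ r → p ⊆ r ∪ ∁ q
q⊆r⇒p⊆r∪∁q {q = q} q⊆r {x} _ with x ∈? q
... | yes x∈q = x∈p∪q⁺ (inj₁ (q⊆r x∈q))
... | no  x∉q = x∈p∪q⁺ (inj₂ (x∉p⇒x∈∁p x∉q))

p⊆q∪s⇒p∩r⊆q∩r : ∀ {n} {p q r s : Subset n} → r ⊆ ∁ s → p ⊆ q ∪ s → p ∩ r ⊆ q ∩ r
p⊆q∪s⇒p∩r⊆q∩r {p = p} {q} {r} {s} r⊆∁s p⊆q∪s x∈p∩r with x∈p∩q⁻ p r x∈p∩r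
... | x∈p , x∈r with x∈p∪q⁻ q s (p⊆q∪s x∈p)
...   | inj₁ x∈q = x∈p∩q⁺ (x∈q , x∈r)
...   | inj₂ x∈s = contradiction x∈s (x∈∁p⇒x∉p (r⊆∁s x∈r))

∈⋃⁺ : ∀ {n} {x : Fin n} {p} (ps : List (Subset n)) → p ∈ₗ ps → x ∈ p → x ∈ ⋃ ps
∈⋃⁺ (p ∷ ps) (here refl) x∈p = x∈p∪q⁺ (inj₁ x∈p)
∈⋃⁺ (q ∷ ps) (there p∈ps) x∈p = x∈p∪q⁺ (inj₂ (∈⋃⁺ ps p∈ps x∈p))

∈⋃⁻ : ∀ {n} {x : Fin n} (ps : List (Subset n)) → x ∈ ⋃ ps → ∃ λ p → p ∈ₗ ps × x ∈ p
∈⋃⁻ []       x∈⋃ = contradiction x∈⋃ ∉⊥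
∈⋃⁻ (p ∷ ps) x∈⋃ with x∈p∪q⁻ p (⋃ ps) x∈⋃
... | inj₁ x∈p   = p , here refl , x∈p
... | inj₂ x∈⋃ps = let q , q∈ps , x∈q = ∈⋃⁻ ps x∈⋃ps in q , there q∈ps , x∈q

module _ {n} (G : Graph n) where

  x∈N[x] : ∀ x → x ∈ N[ G ] x
  x∈N[x] x = lookup⇒[]= x (N[ G ] x)
    (trans (lookup∘tabulate _ x) (cong (_∨ adj G x x) (Equivalence.to T-≡ (fromWitness refl))))

  private
    members : Subset n → List (Fin n)
    members X = filterᵇ (lookup X) (allFin n)

    ∈members⁺ : ∀ {X y} → y ∈ X → y ∈ₗ members X
    ∈members⁺ {X} {y} y∈X =
      ∈-filter⁺ (λ z → T? (lookup X z)) (∈-allFin y) (Equivalence.from T-≡ ([]=⇒lookup y∈X))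

    ∈members⁻ : ∀ {X y} → y ∈ₗ members X → y ∈ X
    ∈members⁻ {X} {y} y∈ =
      lookup⇒[]= y X (Equivalence.to T-≡ (proj₂ (∈-filter⁻ (λ z → T? (lookup X z)) {xs = allFin n} y∈)))

  ∈N[]ˢ⁺ : ∀ {X x y} → y ∈ X → x ∈ N[ G ] y → x ∈ N[ G ]ˢ X
  ∈N[]ˢ⁺ {X} y∈X = ∈⋃⁺ (map (N[ G ]_) (members X)) (∈-map⁺ (N[ G ]_) (∈members⁺ y∈X))

  ∈N[]ˢ⁻ : ∀ {X x} → x ∈ N[ G ]ˢ X → ∃ λ y → y ∈ X × x ∈ N[ G ] y
  ∈N[]ˢ⁻ {X} x∈N[X] with ∈⋃⁻ (map (N[ G ]_) (members X)) x∈N[X]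
  ... | _ , s∈ , x∈s with ∈-map⁻ (N[ G ]_) s∈
  ...   | y , y∈ , refl = y , ∈members⁻ y∈ , x∈s

  N[]ˢ-mono : ∀ {X Y} → X ⊆ Y → N[ G ]ˢ X ⊆ N[ G ]ˢ Y
  N[]ˢ-mono X⊆Y x∈N[X] = let y , y∈X , x∈N[y] = ∈N[]ˢ⁻ x∈N[X] in ∈N[]ˢ⁺ (X⊆Y y∈X) x∈N[y]

  X⊆N[X] : ∀ {X} → X ⊆ N[ G ]ˢ X
  X⊆N[X] {x = x} x∈X = ∈N[]ˢ⁺ x∈X (x∈N[x] x)

  N[X∪⁅y⁆]≡N[X]∪N[y] : ∀ X y → N[ G ]ˢ (X ∪ ⁅ y ⁆) ≡ N[ G ]ˢ X ∪ N[ G ] y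
  N[X∪⁅y⁆]≡N[X]∪N[y] X y = ⊆-antisym to from
    where
    to : N[ G ]ˢ (X ∪ ⁅ y ⁆) ⊆ N[ G ]ˢ X ∪ N[ G ] y
    to x∈ with ∈N[]ˢ⁻ x∈
    ... | z , z∈X∪y , x∈N[z] with x∈p∪q⁻ X ⁅ y ⁆ z∈X∪y
    ...   | inj₁ z∈X = x∈p∪q⁺ (inj₁ (∈N[]ˢ⁺ z∈X x∈N[z]))
    ...   | inj₂ z∈y = x∈p∪q⁺ (inj₂ (subst (λ w → _ ∈ N[ G ] w) (x∈⁅y⁆⇒x≡y y z∈y) x∈N[z]))
    from : N[ G ]ˢ X ∪ N[ G ] y ⊆ N[ G ]ˢ (X ∪ ⁅ y ⁆)
    from x∈ = [ N[]ˢ-mono (p⊆p∪q {p = X} ⁅ y ⁆) , ∈N[]ˢ⁺ {X ∪ ⁅ y ⁆} (x∈p∪q⁺ (inj₂ (x∈⁅x⁆ y))) ]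
                (x∈p∪q⁻ (N[ G ]ˢ X) (N[ G ] y) x∈)

  N[X]∪⁅u⁆⊆N[X∪⁅y⁆] : ∀ X {u y} → u ∈ N[ G ] y → N[ G ]ˢ X ∪ ⁅ u ⁆ ⊆ N[ G ]ˢ (X ∪ ⁅ y ⁆)
  N[X]∪⁅u⁆⊆N[X∪⁅y⁆] X {u} {y} u∈N[y] x∈ with x∈p∪q⁻ (N[ G ]ˢ X) ⁅ u ⁆ x∈
  ... | inj₁ x∈N[X] = N[]ˢ-mono (p⊆p∪q {p = X} ⁅ y ⁆) x∈N[X]
  ... | inj₂ x∈u rewrite x∈⁅y⁆⇒x≡y u x∈u = ∈N[]ˢ⁺ {X ∪ ⁅ y ⁆} (x∈p∪q⁺ (inj₂ (x∈⁅x⁆ y))) u∈N[y]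

  record FreshEdge (X : Subset n) : Set where
    field
      v u     : Fin n
      v∉N[X]  : v ∉ N[ G ]ˢ X
      u∉N[X]  : u ∉ N[ G ]ˢ X
      u∈N[v]  : u ∈ N[ G ] v
      u≢v     : u ≢ v

    v∉X∪⁅u⁆ : v ∉ X ∪ ⁅ u ⁆
    v∉X∪⁅u⁆ v∈ with x∈p∪q⁻ X ⁅ u ⁆ v∈
    ... | inj₁ v∈X = v∉N[X] (X⊆N[X] v∈X)
    ... | inj₂ v∈u = u≢v (sym (x∈⁅y⁆⇒x≡y u v∈u))

-- A separate module, so that ℕ's _*_ does not clash with ℚ's in the statement of theorem35.
module Combinatorial where

  open import Data.Nat using (_*_)

  j*[2+d]≤n⇒j<n : ∀ {j d n} → 0 < n → j * (2 + d) ≤ n → j < n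
  j*[2+d]≤n⇒j<n {zero}      0<n _         = 0<n
  j*[2+d]≤n⇒j<n {suc j} {d} _   j*[2+d]≤n = <-≤-trans (m<m*n (suc j) (2 + d) (s≤s (s≤s z≤n))) j*[2+d]≤n

  module _ {n} {G : Graph n} {k ℓ} (G∈Gr : InGr G k ℓ) where

    separation : ∀ {X Y S} → k ≤ n → X ≢ Y → ∣ X ∣ ≤ ℓ → ∣ Y ∣ ≤ ℓ →
                 N[ G ]ˢ X ⊆ N[ G ]ˢ Y ∪ S → N[ G ]ˢ Y ⊆ N[ G ]ˢ X ∪ S → n ∸ k < ∣ S ∣
    separation {X} {Y} {S} k≤n X≢Y ∣X∣≤ℓ ∣Y∣≤ℓ X⊆Y∪S Y⊆X∪S = ≰⇒> λ ∣S∣≤n∸k →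
      let C , C⊆∁S , ∣C∣≡k = k≤∣p∣⇒∃[C⊆p]∣C∣≡k k (∁ S) (k≤∣∁S∣ ∣S∣≤n∸k)
      in G∈Gr C ∣C∣≡k X Y ∣X∣≤ℓ ∣Y∣≤ℓ X≢Y
           (⊆-antisym (p⊆q∪s⇒p∩r⊆q∩r C⊆∁S X⊆Y∪S) (p⊆q∪s⇒p∩r⊆q∩r C⊆∁S Y⊆X∪S))
      where
      k≤∣∁S∣ : ∣ S ∣ ≤ n ∸ k → k ≤ ∣ ∁ S ∣
      k≤∣∁S∣ ∣S∣≤n∸k = begin
        k              ≡⟨ m∸[m∸n]≡n k≤n ⟨
        n ∸ (n ∸ k)    ≤⟨ ∸-monoʳ-≤ n ∣S∣≤n∸k ⟩
        n ∸ ∣ S ∣      ≡⟨ ∣∁p∣≡n∸∣p∣ S ⟨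
        ∣ ∁ S ∣        ∎
        where open ≤-Reasoning

    n∸k<∣N[v]─N[X]∣ : ∀ {X v} → k ≤ n → v ∉ X → suc ∣ X ∣ ≤ ℓ → n ∸ k < ∣ N[ G ] v ─ N[ G ]ˢ X ∣
    n∸k<∣N[v]─N[X]∣ {X} {v} k≤n v∉X 1+∣X∣≤ℓ =
      separation k≤n X≢X∪v (<⇒≤ 1+∣X∣≤ℓ) (≤-trans (∣p∪⁅x⁆∣≤1+∣p∣ X v) 1+∣X∣≤ℓ)
        (p⊆p∪q _ ∘ N[]ˢ-mono G (p⊆p∪q {p = X} ⁅ v ⁆))
        (p∪q⊆p∪[q─p] _ _ ∘ subst (_ ∈_) (N[X∪⁅y⁆]≡N[X]∪N[y] G X v))
      where
      X≢X∪v : X ≢ X ∪ ⁅ v ⁆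
      X≢X∪v X≡X∪v = v∉X (subst (v ∈_) (sym X≡X∪v) (x∈p∪q⁺ (inj₂ (x∈⁅x⁆ v))))

    2+n∸k≤∣N[v]─N[X]∣ : ∀ {X} → k ≤ n → 2 + ∣ X ∣ ≤ ℓ → (e : FreshEdge G X) →
                        2 + (n ∸ k) ≤ ∣ N[ G ] (FreshEdge.v e) ─ N[ G ]ˢ X ∣
    2+n∸k≤∣N[v]─N[X]∣ {X} k≤n 2+∣X∣≤ℓ e = begin-strict
      suc (n ∸ k)                                 <⟨ s≤s (n∸k<∣N[v]─N[X]∣ {X ∪ ⁅ u ⁆} k≤n v∉X∪⁅u⁆ 1+∣X∪u∣≤ℓ) ⟩
      suc (∣ N[ G ] v ─ N[ G ]ˢ (X ∪ ⁅ u ⁆) ∣)    ≤⟨ s≤s (p⊆q⇒∣p∣≤∣q∣ (q⊆r⇒p─r⊆p─q {p = N[ G ] v} N[X]∪⁅u⁆⊆N[X∪⁅u⁆])) ⟩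
      suc (∣ N[ G ] v ─ (N[ G ]ˢ X ∪ ⁅ u ⁆) ∣)    ≡⟨ cong (suc ∘ ∣_∣) (p─q─r≡p─q∪r (N[ G ] v) (N[ G ]ˢ X) ⁅ u ⁆) ⟨
      suc (∣ N[ G ] v ─ N[ G ]ˢ X ─ ⁅ u ⁆ ∣)      ≤⟨ x∈p⇒∣p-x∣<∣p∣ (x∈p∧x∉q⇒x∈p─q u∈N[v] u∉N[X]) ⟩
      (∣ N[ G ] v ─ N[ G ]ˢ X ∣)                  ∎
      where
      open FreshEdge e
      open ≤-Reasoning
      1+∣X∪u∣≤ℓ : suc ∣ X ∪ ⁅ u ⁆ ∣ ≤ ℓ
      1+∣X∪u∣≤ℓ = ≤-trans (s≤s (∣p∪⁅x⁆∣≤1+∣p∣ X u)) 2+∣X∣≤ℓ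
      N[X]∪⁅u⁆⊆N[X∪⁅u⁆] : N[ G ]ˢ X ∪ ⁅ u ⁆ ⊆ N[ G ]ˢ (X ∪ ⁅ u ⁆)
      N[X]∪⁅u⁆⊆N[X∪⁅u⁆] = N[X]∪⁅u⁆⊆N[X∪⁅y⁆] G X (x∈N[x] G u)

    2+n∸k≤∣∁N[X]∣ : ∀ {X} → k ≤ n → suc ∣ X ∣ ≤ ℓ → FreshEdge G X → 2 + (n ∸ k) ≤ ∣ ∁ (N[ G ]ˢ X) ∣
    2+n∸k≤∣∁N[X]∣ {X} k≤n 1+∣X∣≤ℓ e = ≤-<-trans
      (separation {S = ∁ (N[ G ]ˢ X ∪ ⁅ u ⁆)} k≤n X∪v≢X∪u (size v) (size u)
        (q⊆r⇒p⊆r∪∁q (N[X]∪⁅u⁆⊆N[X∪⁅y⁆] G X (x∈N[x] G u)))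
        (q⊆r⇒p⊆r∪∁q (N[X]∪⁅u⁆⊆N[X∪⁅y⁆] G X u∈N[v])))
      (p⊂q⇒∣p∣<∣q∣ (p⊂q⇒∁p⊃∁q N[X]⊂N[X]∪⁅u⁆))
      where
      open FreshEdge e
      size : ∀ w → ∣ X ∪ ⁅ w ⁆ ∣ ≤ ℓ
      size w = ≤-trans (∣p∪⁅x⁆∣≤1+∣p∣ X w) 1+∣X∣≤ℓ
      X∪v≢X∪u : X ∪ ⁅ v ⁆ ≢ X ∪ ⁅ u ⁆
      X∪v≢X∪u eq = v∉X∪⁅u⁆ (subst (v ∈_) eq (x∈p∪q⁺ (inj₂ (x∈⁅x⁆ v))))
      N[X]⊂N[X]∪⁅u⁆ : N[ G ]ˢ X ⊂ N[ G ]ˢ X ∪ ⁅ u ⁆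
      N[X]⊂N[X]∪⁅u⁆ = p⊆p∪q ⁅ u ⁆ , u , x∈p∪q⁺ (inj₂ (x∈⁅x⁆ u)) , u∉N[X]

    fresh-edge : ∀ {X} → k < n → suc ∣ X ∣ ≤ ℓ → ∣ X ∣ < n → FreshEdge G X
    fresh-edge {X} k<n 1+∣X∣≤ℓ ∣X∣<n =
      let w , w∉X = ∣p∣<n⇒∃[x∉p] X ∣X∣<n
          v , v∈N[w]─N[X] = 0<∣p∣⇒Nonempty (N[ G ] w ─ N[ G ]ˢ X) (≤-<-trans z≤n (n∸k<∣N[v]─N[X]∣ {X} k≤n w∉X 1+∣X∣≤ℓ))
          v∉N[X] = x∈p─q⇒x∉q v∈N[w]─N[X]
          u , u∈N[v]─N[X] , u≢v = 1<∣p∣⇒∃[x∈p]x≢y (N[ G ] v ─ N[ G ]ˢ X)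
            (≤-<-trans (m<n⇒0<n∸m k<n) (n∸k<∣N[v]─N[X]∣ {X} k≤n (v∉N[X] ∘ X⊆N[X] G) 1+∣X∣≤ℓ)) v
      in record
        { v = v ; u = u ; v∉N[X] = v∉N[X] ; u∉N[X] = x∈p─q⇒x∉q u∈N[v]─N[X]
        ; u∈N[v] = p─q⊆p _ _ u∈N[v]─N[X] ; u≢v = u≢v }
      where
      k≤n : k ≤ n
      k≤n = <⇒≤ k<n

    WellSpread : ℕ → Set
    WellSpread j = ∃ λ X → ∣ X ∣ ≤ j × j * (2 + (n ∸ k)) ≤ ∣ N[ G ]ˢ X ∣

    well-spread⇒∣X∣<n : ∀ {X j} → k < n → ∣ X ∣ ≤ j → j * (2 + (n ∸ k)) ≤ ∣ N[ G ]ˢ X ∣ → ∣ X ∣ < n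
    well-spread⇒∣X∣<n {X} k<n ∣X∣≤j j*c≤∣N[X]∣ =
      ≤-<-trans ∣X∣≤j (j*[2+d]≤n⇒j<n (≤-<-trans z≤n k<n) (≤-trans j*c≤∣N[X]∣ (∣p∣≤n (N[ G ]ˢ X))))

    spread-step : ∀ {j} → k < n → 2 + j ≤ ℓ → WellSpread j → WellSpread (suc j)
    spread-step {j} k<n 2+j≤ℓ (X , ∣X∣≤j , j*c≤∣N[X]∣) =
      X ∪ ⁅ v ⁆ , ≤-trans (∣p∪⁅x⁆∣≤1+∣p∣ X v) (s≤s ∣X∣≤j) , (begin
        suc j * c                                     ≡⟨ +-comm c (j * c) ⟩
        j * c + c                                     ≤⟨ +-mono-≤ j*c≤∣N[X]∣ (2+n∸k≤∣N[v]─N[X]∣ (<⇒≤ k<n) 2+∣X∣≤ℓ e) ⟩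
        (∣ N[ G ]ˢ X ∣) + (∣ N[ G ] v ─ N[ G ]ˢ X ∣)  ≡⟨ ∣p∪q∣≡∣p∣+∣q─p∣ (N[ G ]ˢ X) (N[ G ] v) ⟨
        (∣ N[ G ]ˢ X ∪ N[ G ] v ∣)                    ≡⟨ cong ∣_∣ (N[X∪⁅y⁆]≡N[X]∪N[y] G X v) ⟨
        (∣ N[ G ]ˢ (X ∪ ⁅ v ⁆) ∣)                     ∎)
      where
      open ≤-Reasoning
      c : ℕ
      c = 2 + (n ∸ k)
      2+∣X∣≤ℓ : 2 + ∣ X ∣ ≤ ℓ
      2+∣X∣≤ℓ = ≤-trans (s≤s (s≤s ∣X∣≤j)) 2+j≤ℓ
      e : FreshEdge G X
      e = fresh-edge k<n (<⇒≤ 2+∣X∣≤ℓ) (well-spread⇒∣X∣<n {X} k<n ∣X∣≤j j*c≤∣N[X]∣)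
      open FreshEdge e using (v)

    spread-final : ∀ {j} → k < n → suc j ≤ ℓ → WellSpread j → suc j * (2 + (n ∸ k)) ≤ n
    spread-final {j} k<n 1+j≤ℓ (X , ∣X∣≤j , j*c≤∣N[X]∣) = begin
      suc j * c                                  ≡⟨ +-comm c (j * c) ⟩
      j * c + c                                  ≤⟨ +-mono-≤ j*c≤∣N[X]∣ (2+n∸k≤∣∁N[X]∣ (<⇒≤ k<n) 1+∣X∣≤ℓ e) ⟩
      (∣ N[ G ]ˢ X ∣) + (∣ ∁ (N[ G ]ˢ X) ∣)      ≡⟨ ∣p∣+∣∁p∣≡n (N[ G ]ˢ X) ⟩
      n                                          ∎
      where
      open ≤-Reasoning
      c : ℕ
      c = 2 + (n ∸ k)
      1+∣X∣≤ℓ : suc ∣ X ∣ ≤ ℓ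
      1+∣X∣≤ℓ = ≤-trans (s≤s ∣X∣≤j) 1+j≤ℓ
      e : FreshEdge G X
      e = fresh-edge k<n 1+∣X∣≤ℓ (well-spread⇒∣X∣<n {X} k<n ∣X∣≤j j*c≤∣N[X]∣)

    spread : ∀ {j} → k < n → j < ℓ → WellSpread j
    spread {zero}  _   _      = ⊥ , ≤-reflexive (∣⊥∣≡0 n) , z≤n
    spread {suc j} k<n 1+j<ℓ = spread-step k<n 1+j<ℓ (spread k<n (<⇒≤ 1+j<ℓ))

  neighbourhood-bound : ∀ {n} {G : Graph n} {k ℓ} → InGr G k ℓ → k < n → ℓ * (2 + (n ∸ k)) ≤ n
  neighbourhood-bound {ℓ = zero}  _    _   = z≤n
  neighbourhood-bound {G = G} {ℓ = suc _} G∈Gr k<n =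
    spread-final {G = G} G∈Gr k<n ≤-refl (spread {G = G} G∈Gr k<n ≤-refl)

  private
    regroup : ∀ m d e → (2 + m) * (2 + d) + e ≡ (2 + ((1 + m) * (2 + d) + e)) + d
    regroup = solve-∀

    expand : ∀ m d e → (2 + ((1 + m) * (2 + d) + e) + d) * (1 + m) + e ≡ (2 + m) * ((1 + m) * (2 + d) + e)
    expand = solve-∀

  cross-multiply : ∀ m {k n} → k ≤ n → (2 + m) * (2 + (n ∸ k)) ≤ n →
                   2 ≤ k × n * suc m ≤ (2 + m) * (k ∸ 2)
  -- With n = k + d, the hypothesis forces k = 2 + (m + 1)(2 + d) + e, and then the two sides of the
  -- conclusion differ by exactly e.
  cross-multiply m {k} {n} k≤n ℓ[2+d]≤n with n ∸ k | m+[n∸m]≡n k≤n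
  ... | d | refl with m≤n⇒∃[o]m+o≡n ℓ[2+d]≤n
  ... | e , ℓ[2+d]+e≡k+d with +-cancelʳ-≡ d (2 + ((1 + m) * (2 + d) + e)) k (trans (sym (regroup m d e)) ℓ[2+d]+e≡k+d)
  ... | refl = s≤s (s≤s z≤n) , ≤-trans (m≤m+n _ e) (≤-reflexive (expand m d e))

open Combinatorial using (neighbourhood-bound; cross-multiply)

open import Data.Integer as ℤ using (+_; +≤+)
import Data.Integer.Properties as ℤ
open import Data.Rational using (ℚ; _/_; _*_; _-_; _⊔_; toℚᵘ)
open import Data.Rational using () renaming (_≤_ to _≤ℚ_)
import Data.Rational as ℚ
open import Data.Rational.Properties
  using (toℚᵘ-cancel-≤; toℚᵘ-fromℚᵘ; toℚᵘ-homo-*; toℚᵘ-homo-+; toℚᵘ-homo‿-; p≤q⇒p≤q⊔r; p≤q⇒p≤r⊔q)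
open import Data.Rational.Unnormalised as ℚᵘ using (mkℚᵘ; *≤*)
import Data.Rational.Unnormalised.Properties as ℚᵘ

toℚᵘ-/1 : ∀ m → toℚᵘ (+ m / 1) ℚᵘ.≃ mkℚᵘ (+ m) 0
toℚᵘ-/1 m = toℚᵘ-fromℚᵘ (mkℚᵘ (+ m) 0)

/1-mono-≤ : ∀ {m n} → m ≤ n → (+ m / 1) ≤ℚ (+ n / 1)
/1-mono-≤ {m} {n} m≤n = toℚᵘ-cancel-≤ (begin
  toℚᵘ (+ m / 1)  ≃⟨ toℚᵘ-/1 m ⟩
  mkℚᵘ (+ m) 0    ≤⟨ *≤* (ℤ.*-monoʳ-≤-nonNeg (+ 1) (+≤+ m≤n)) ⟩
  mkℚᵘ (+ n) 0    ≃⟨ toℚᵘ-/1 n ⟨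
  toℚᵘ (+ n / 1)  ∎)
  where open ℚᵘ.≤-Reasoning

cross-multiplied⇒≤ℚ : ∀ {n a b k} → 2 ≤ k → n ℕ.* suc b ≤ a ℕ.* (k ∸ 2) →
                      (+ n / 1) ≤ℚ ((+ a / suc b) * ((+ k / 1) - (+ 2 / 1)))
cross-multiplied⇒≤ℚ {n} {a} {b} (s≤s (s≤s {n = k} _)) n[b+1]≤ak = toℚᵘ-cancel-≤ (begin
  toℚᵘ (+ n / 1)                                             ≃⟨ toℚᵘ-/1 n ⟩
  mkℚᵘ (+ n) 0                                               ≤⟨ *≤* cross ⟩
  mkℚᵘ (+ a) b ℚᵘ.* (mkℚᵘ (+ (2 + k)) 0 ℚᵘ.- mkℚᵘ (+ 2) 0)   ≃⟨ toℚᵘ-homo ⟨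
  toℚᵘ ((+ a / suc b) * ((+ (2 + k) / 1) - (+ 2 / 1)))       ∎)
  where
  open ℚᵘ.≤-Reasoning
  cross : + n ℤ.* + suc (b ℕ.* 1) ℤ.≤ (+ a ℤ.* + (k ℕ.* 1)) ℤ.* + 1
  cross rewrite ℕ.*-identityʳ b | ℕ.*-identityʳ k | ℤ.*-identityʳ (+ a ℤ.* + k)
              | sym (ℤ.pos-* n (suc b)) | sym (ℤ.pos-* a k) = +≤+ n[b+1]≤ak
  toℚᵘ-homo : toℚᵘ ((+ a / suc b) * ((+ (2 + k) / 1) - (+ 2 / 1)))
              ℚᵘ.≃ mkℚᵘ (+ a) b ℚᵘ.* (mkℚᵘ (+ (2 + k)) 0 ℚᵘ.- mkℚᵘ (+ 2) 0)
  toℚᵘ-homo = ℚᵘ.≃-trans (toℚᵘ-homo-* (+ a / suc b) ((+ (2 + k) / 1) - (+ 2 / 1)))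
    (ℚᵘ.*-cong (toℚᵘ-fromℚᵘ (mkℚᵘ (+ a) b))
      (ℚᵘ.≃-trans (toℚᵘ-homo-+ (+ (2 + k) / 1) (ℚ.- (+ 2 / 1)))
        (ℚᵘ.+-cong (toℚᵘ-/1 (2 + k)) (ℚᵘ.≃-trans (toℚᵘ-homo‿- (+ 2 / 1)) (ℚᵘ.-‿cong (toℚᵘ-/1 2))))))

theorem35 : (k ℓ : ℕ) → 2 ≤ ℓ → 1 ≤ k → .{{_ : NonZero (ℓ ∸ 1)}} →
    (n : ℕ) → k ≤ n → (G : Graph n) → InGr G k ℓ →
    (+ n / 1) ≤ℚ (((+ ℓ / (ℓ ∸ 1)) * ((+ k / 1) - (+ 2 / 1))) ⊔ (+ k / 1))
theorem35 k (suc (suc m)) (s≤s (s≤s _)) _ n k≤n G G∈Gr with n ≤? k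
... | yes n≤k = p≤q⇒p≤r⊔q ((+ suc (suc m) / suc m) * ((+ k / 1) - (+ 2 / 1))) (/1-mono-≤ n≤k)
... | no  n≰k =
  let 2≤k , n[ℓ-1]≤ℓ[k-2] = cross-multiply m k≤n (neighbourhood-bound {G = G} G∈Gr (≰⇒> n≰k))
  in p≤q⇒p≤q⊔r (+ k / 1) (cross-multiplied⇒≤ℚ {n} {suc (suc m)} {m} 2≤k n[ℓ-1]≤ℓ[k-2])
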